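{- Let $p$ be a prime and let $S \subseteq (\mathbb{Z}/p\mathbb{Z})^{\times}$ be the multiplicative closure (the set of all finite products) of the set $\left\{ \binom{2d}{d} \bmod p : 0 \leq d \leq \frac{p-1}{2} \right\}$. Then $S = (\mathbb{Z}/p\mathbb{Z})^{\times}$, i.e. $S$ contains every non-zero residue modulo $p$.
   Context: Each $\binom{2d}{d}$ with $0 \le d \le \frac{p-1}{2}$ is non-zero modulo $p$ since $2d \le p-1$, so the generating set lies in $(\mathbb{Z}/p\mathbb{Z})^{\times}$. -}

module Defs where

open import Data.Nat using (ℕ; _*_; _≤_; _∸_; _/_; NonZero)
open import Data.Nat.DivMod using (_%_)
open import Data.Nat.Combinatorics using (_C_)

-- Residues mod p are represented by naturals r with r < p (canonical reps r % p).
-- centralBinomial d = binom(2d, d)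
centralBinomial : ℕ → ℕ
centralBinomial d = (d * 2) C d

data MulClosure (p : ℕ) .{{_ : NonZero p}} : ℕ → Set where
  gen : ∀ d → d ≤ (p ∸ 1) / 2 → MulClosure p (centralBinomial d % p)
  mul : ∀ {a b} → MulClosure p a → MulClosure p b → MulClosure p ((a * b) % p)

module Submission where

-- Proof by strong induction on a residue k with 1 ≤ k < p.
--   * k = 1 is binom(0,0).
--   * k = 2h: 2 = binom(2,1) and h < k are both products of generators.
--   * k = 2h+1 with h ≥ 1: the identity
--         (h+1)·binom(2h+2,h+1) = 2·(2h+1)·binom(2h,h)
--     gives  2h+1 ≡ (h+1)·binom(2h+2,h+1)·w⁻¹ (mod p)  for w = 2·binom(2h,h).
--     Here h+1 < k, the index h+1 is admissible since 2h+2 ≠ p (p is odd),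
--     and w is prime to p because 2h < p.  An inverse of w lying in the
--     closure exists because some power w^(k+1) is ≡ 1 (pigeonhole on powers).

open import Defs
open import Data.Nat using (ℕ; _≤_; _<_; NonZero)
open import Data.Nat.Primality using (Prime; prime⇒nonZero)

open import Data.Nat.Base
  using (zero; suc; _+_; _*_; _∸_; _/_; _^_; _!; z≤n; s≤s; nonTrivial⇒n>1)
open import Data.Nat.Properties
open import Data.Nat.DivMod
open import Data.Nat.Divisibility using (_∣_; _∤_; divides; ∣⇒≤; ∣m⇒∣m*n)
open import Data.Nat.Combinatorics
  using (_C_; nCk≡nC[n∸k]; nCk+nC[k+1]≡[n+1]C[k+1]; nC1≡n; nCk≡n!/k![n-k]!; k![n∸k]!∣n!)
open import Data.Nat.Induction using (<-rec)
open import Data.Nat.Primality using (euclidsLemma; prime⇒irreducible; prime⇒nonTrivial)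
open import Data.Product using (∃; _×_; _,_)
open import Data.Sum using (inj₁; inj₂)
open import Data.Fin using (toℕ; fromℕ<)
open import Data.Fin.Properties using (pigeonhole; toℕ-fromℕ<)
open import Relation.Nullary using (yes; no; contradiction)
open import Relation.Binary.PropositionalEquality
open import Algebra.Properties.CommutativeSemigroup *-commutativeSemigroup using (x∙yz≈y∙xz)

absorption : ∀ n k → suc k * (suc n C suc k) ≡ suc n * (n C k)
absorption zero    zero    = refl
absorption zero    (suc k) = *-zeroʳ (suc (suc k))
absorption (suc n) zero    = trans (+-identityʳ (suc (suc n) C 1))
                                   (trans (nC1≡n (suc (suc n))) (sym (*-identityʳ (suc (suc n)))))
absorption (suc n) (suc k) = begin
  suc (suc k) * (suc (suc n) C suc (suc k))
    ≡⟨ cong (suc (suc k) *_) (nCk+nC[k+1]≡[n+1]C[k+1] (suc n) (suc k)) ⟨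
  suc (suc k) * (a + b)
    ≡⟨ *-distribˡ-+ (suc (suc k)) a b ⟩
  (a + suc k * a) + suc (suc k) * b
    ≡⟨ cong₂ (λ s t → (a + s) + t) (absorption n k) (absorption n (suc k)) ⟩
  (a + suc n * (n C k)) + suc n * (n C suc k)
    ≡⟨ +-assoc a _ _ ⟩
  a + (suc n * (n C k) + suc n * (n C suc k))
    ≡⟨ cong (a +_) (*-distribˡ-+ (suc n) (n C k) (n C suc k)) ⟨
  a + suc n * (n C k + n C suc k)
    ≡⟨ cong (λ t → a + suc n * t) (nCk+nC[k+1]≡[n+1]C[k+1] n k) ⟩
  suc (suc n) * a ∎
  where
  open ≡-Reasoning
  a = suc n C suc k
  b = suc n C suc (suc k)

centralBinomial-step : ∀ h →
  suc h * centralBinomial (suc h) ≡ 2 * (suc (h * 2) * centralBinomial h)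
centralBinomial-step h = begin
  suc h * (suc (suc N) C suc h)  ≡⟨ absorption (suc N) h ⟩
  suc (suc N) * (suc N C h)      ≡⟨ cong (suc (suc N) *_) symmetry ⟩
  suc (suc N) * (suc N C suc h)  ≡⟨ cong (_* (suc N C suc h)) (*-comm (suc h) 2) ⟩
  2 * suc h * (suc N C suc h)    ≡⟨ *-assoc 2 (suc h) _ ⟩
  2 * (suc h * (suc N C suc h))  ≡⟨ cong (2 *_) (absorption N h) ⟩
  2 * (suc N * (N C h))          ∎
  where
  open ≡-Reasoning
  N = h * 2
  h≤N : h ≤ N
  h≤N = m≤m*n h 2
  symmetry : suc N C h ≡ suc N C suc h
  symmetry = trans (nCk≡nC[n∸k] (m≤n⇒m≤1+n h≤N))
               (cong (suc N C_) (trans (+-∸-assoc 1 h≤N) (cong suc N∸h≡h)))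
    where
    N∸h≡h : N ∸ h ≡ h
    N∸h≡h = trans (cong (_∸ h) (trans (*-comm h 2) (cong (h +_) (+-identityʳ h))))
                  (m+n∸m≡n h h)

data Parity : ℕ → Set where
  even : ∀ h → Parity (h * 2)
  odd  : ∀ h → Parity (suc (h * 2))

parity : ∀ n → Parity n
parity zero = even 0
parity (suc n) with parity n
... | even h = odd h
... | odd h  = even (suc h)

double<⇒≤half : ∀ {p} d → d * 2 < p → d ≤ (p ∸ 1) / 2
double<⇒≤half {p} d lt = subst (_≤ (p ∸ 1) / 2) (m*n/n≡m d 2) (/-mono-≤ (<⇒≤pred lt) ≤-refl)

%≡⇒∣∸ : ∀ {n} .{{_ : NonZero n}} x y → x % n ≡ y % n → n ∣ x ∸ y
%≡⇒∣∸ {n} x y e = divides (x / n ∸ y / n) (begin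
  x ∸ y                                     ≡⟨ cong₂ _∸_ (m≡m%n+[m/n]*n x n) (m≡m%n+[m/n]*n y n) ⟩
  (x % n + x / n * n) ∸ (y % n + y / n * n) ≡⟨ cong (λ t → (t + x / n * n) ∸ (y % n + y / n * n)) e ⟩
  (y % n + x / n * n) ∸ (y % n + y / n * n) ≡⟨ [m+n]∸[m+o]≡n∸o (y % n) _ _ ⟩
  x / n * n ∸ y / n * n                     ≡⟨ *-distribʳ-∸ n (x / n) (y / n) ⟨
  (x / n ∸ y / n) * n                       ∎)
  where open ≡-Reasoning

module ModPrime (p : ℕ) (pr : Prime p) where

  instance
    p≢0 : NonZero p
    p≢0 = prime⇒nonZero pr

  2≤p : 2 ≤ p
  2≤p = nonTrivial⇒n>1 p {{prime⇒nonTrivial pr}}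

  p∤1 : p ∤ 1
  p∤1 d = <⇒≱ 2≤p (∣⇒≤ d)

  ∤-^ : ∀ {x} → p ∤ x → ∀ n → p ∤ x ^ n
  ∤-^ p∤x zero          = p∤1
  ∤-^ {x} p∤x (suc n) d with euclidsLemma x (x ^ n) pr d
  ... | inj₁ p∣x  = p∤x p∣x
  ... | inj₂ p∣xⁿ = ∤-^ p∤x n p∣xⁿ

  ∤-! : ∀ {n} → n < p → p ∤ n !
  ∤-! {zero}  _  = p∤1
  ∤-! {suc n} lt d with euclidsLemma (suc n) (n !) pr d
  ... | inj₁ p∣n+1 = <⇒≱ lt (∣⇒≤ p∣n+1)
  ... | inj₂ p∣n!  = ∤-! (<-trans (n<1+n n) lt) p∣n!

  ∤-C : ∀ {n k} → k ≤ n → n < p → p ∤ n C k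
  ∤-C {n} {k} k≤n lt d = ∤-! lt (subst (p ∣_) binomial*factorials (∣m⇒∣m*n (k ! * (n ∸ k) !) d))
    where
    instance _ = k !* (n ∸ k) !≢0
    binomial*factorials : (n C k) * (k ! * (n ∸ k) !) ≡ n !
    binomial*factorials = trans (cong (_* (k ! * (n ∸ k) !)) (nCk≡n!/k![n-k]! k≤n))
                                (m/n*n≡m (k![n∸k]!∣n! k≤n))

  ≢double : ∀ {m} → 2 ≤ m → m * 2 ≢ p
  ≢double {suc m} 2≤m e with prime⇒irreducible pr (divides 2 (trans (sym e) (*-comm (suc m) 2)))
  ... | inj₁ m≡1 = <⇒≱ 2≤m (≤-reflexive m≡1)
  ... | inj₂ m≡p = <-irrefl (trans m≡p (sym e)) (m<m*n (suc m) 2 ≤-refl)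

  cancel-≤ : ∀ a {b c} → p ∤ a → (a * b) % p ≡ (a * c) % p → b ≤ c → b % p ≡ c % p
  cancel-≤ a {b} {c} p∤a e b≤c with euclidsLemma a (c ∸ b) pr p∣a[c∸b]
    where
    p∣a[c∸b] : p ∣ a * (c ∸ b)
    p∣a[c∸b] = subst (p ∣_) (sym (*-distribˡ-∸ a c b)) (%≡⇒∣∸ (a * c) (a * b) (sym e))
  ... | inj₁ p∣a     = contradiction p∣a p∤a
  ... | inj₂ p∣[c∸b] = sym (trans (cong (_% p) (sym (m+[n∸m]≡n b≤c))) (%-remove-+ʳ b p∣[c∸b]))

  cancel : ∀ a {b c} → p ∤ a → (a * b) % p ≡ (a * c) % p → b % p ≡ c % p
  cancel a {b} {c} p∤a e with b ≤? c
  ... | yes b≤c = cancel-≤ a p∤a e b≤c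
  ... | no  b≰c = sym (cancel-≤ a p∤a (sym e) (≰⇒≥ b≰c))

  -- A number prime to p has a power inverse:  x · x^k ≡ 1 (mod p).
  -- Two of the p+1 powers x⁰,…,xᵖ agree mod p; cancel the smaller one.
  power-inverse : ∀ {x} → p ∤ x → ∃ λ k → (x * x ^ k) % p ≡ 1 % p
  power-inverse {x} p∤x with pigeonhole (n<1+n p) (λ i → fromℕ< (m%n<n (x ^ toℕ i) p))
  ... | i , j , i<j , same = k , sym (cancel (x ^ a) (∤-^ p∤x a) powers)
    where
    a = toℕ i
    k = toℕ j ∸ suc a
    xᵃ≡xʲ : x ^ a % p ≡ x ^ toℕ j % p
    xᵃ≡xʲ = trans (sym (toℕ-fromℕ< _)) (trans (cong toℕ same) (toℕ-fromℕ< _))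
    xʲ≡xᵃxᵏ⁺¹ : x ^ toℕ j ≡ x ^ a * x ^ suc k
    xʲ≡xᵃxᵏ⁺¹ = trans (cong (x ^_) (sym (trans (+-suc a k) (m+[n∸m]≡n i<j))))
                      (^-distribˡ-+-* x a (suc k))
    powers : (x ^ a * 1) % p ≡ (x ^ a * x ^ suc k) % p
    powers = trans (cong (_% p) (*-identityʳ _)) (trans xᵃ≡xʲ (cong (_% p) xʲ≡xᵃxᵏ⁺¹))

  *-unit : ∀ a u → u % p ≡ 1 % p → (a * u) % p ≡ a % p
  *-unit a u u≡1 = begin
    (a * u) % p               ≡⟨ %-distribˡ-* a u p ⟩
    ((a % p) * (u % p)) % p   ≡⟨ cong (λ t → ((a % p) * t) % p) u≡1 ⟩
    ((a % p) * (1 % p)) % p   ≡⟨ %-distribˡ-* a 1 p ⟨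
    (a * 1) % p               ≡⟨ cong (_% p) (*-identityʳ a) ⟩
    a % p                     ∎
    where open ≡-Reasoning

module Closure (p : ℕ) (pr : Prime p) where

  open ModPrime p pr

  InClosure : ℕ → Set
  InClosure x = MulClosure p (x % p)

  generator : ∀ d → d * 2 < p → InClosure (centralBinomial d)
  generator d lt = gen d (double<⇒≤half d lt)

  closure-* : ∀ {a b} → InClosure a → InClosure b → InClosure (a * b)
  closure-* {a} {b} ia ib = subst (MulClosure p) (sym (%-distribˡ-* a b p)) (mul ia ib)

  closure-1 : InClosure 1
  closure-1 = generator 0 (≤-trans (s≤s z≤n) 2≤p)

  -- binom(2,1) = 2.
  closure-2 : 3 ≤ p → InClosure 2
  closure-2 3≤p = generator 1 3≤p

  closure-^ : ∀ {x} → InClosure x → ∀ n → InClosure (x ^ n)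
  closure-^ ix zero    = closure-1
  closure-^ ix (suc n) = closure-* ix (closure-^ ix n)

  closure-inverse : ∀ {x} → InClosure x → p ∤ x → ∃ λ y → InClosure y × (x * y) % p ≡ 1 % p
  closure-inverse ix p∤x with power-inverse p∤x
  ... | k , inverse = _ , closure-^ ix k , inverse

  -- Odd step: 2h+1 ≡ (h+1)·binom(2h+2,h+1)·(2·binom(2h,h))⁻¹, given h+1 ∈ closure.
  closure-odd : ∀ h → 1 ≤ h → suc (h * 2) < p → InClosure (suc h) → InClosure (suc (h * 2))
  closure-odd h 1≤h lt ih+1 with closure-inverse w-in w-prime
    where
    3≤p : 3 ≤ p
    3≤p = ≤-trans (s≤s (s≤s (≤-trans (n≤1+n 1) (*-monoˡ-≤ 2 1≤h)))) lt
    w-in : InClosure (2 * centralBinomial h)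
    w-in = closure-* (closure-2 3≤p) (generator h (<-trans (n<1+n _) lt))
    w-prime : p ∤ 2 * centralBinomial h
    w-prime d with euclidsLemma 2 (centralBinomial h) pr d
    ... | inj₁ p∣2 = <⇒≱ 3≤p (∣⇒≤ p∣2)
    ... | inj₂ p∣C = ∤-C (m≤m*n h 2) (<-trans (n<1+n _) lt) p∣C
  ... | y , iy , wy≡1 = subst (MulClosure p) residue (closure-* (closure-* ih+1 binomial) iy)
    where
    K = suc (h * 2)
    binomial : InClosure (centralBinomial (suc h))
    binomial = generator (suc h) (≤∧≢⇒< lt (≢double (s≤s 1≤h)))
    residue : (suc h * centralBinomial (suc h) * y) % p ≡ K % p
    residue = begin
      (suc h * centralBinomial (suc h) * y) % p ≡⟨ cong (λ t → (t * y) % p) (centralBinomial-step h) ⟩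
      (2 * (K * centralBinomial h) * y) % p     ≡⟨ cong (λ t → (t * y) % p) (x∙yz≈y∙xz 2 K (centralBinomial h)) ⟩
      (K * (2 * centralBinomial h) * y) % p     ≡⟨ cong (_% p) (*-assoc K (2 * centralBinomial h) y) ⟩
      (K * (2 * centralBinomial h * y)) % p     ≡⟨ *-unit K (2 * centralBinomial h * y) wy≡1 ⟩
      K % p                                     ∎
      where open ≡-Reasoning

  closure-all : ∀ k → 1 ≤ k → k < p → InClosure k
  closure-all = <-rec (λ k → 1 ≤ k → k < p → InClosure k) step
    where
    step : ∀ k → (∀ {m} → m < k → 1 ≤ m → m < p → InClosure m) → 1 ≤ k → k < p → InClosure k
    step k below 1≤k k<p with parity k
    ... | even zero    = contradiction 1≤k λ ()
    ... | even (suc h) = subst InClosure (*-comm 2 (suc h))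
                           (closure-* (closure-2 (≤-trans (s≤s (s≤s (s≤s z≤n))) k<p))
                                      (below h<k (s≤s z≤n) (<-trans h<k k<p)))
      where
      h<k : suc h < suc h * 2
      h<k = m<m*n (suc h) 2 ≤-refl
    ... | odd zero     = closure-1
    ... | odd (suc h)  = closure-odd (suc h) (s≤s z≤n) k<p
                           (below h<k (s≤s z≤n) (<-trans h<k k<p))
      where
      h<k : suc (suc h) < suc (suc h * 2)
      h<k = s≤s (m<m*n (suc h) 2 ≤-refl)

lemma1 : ∀ (p : ℕ) (pr : Prime p) (a : ℕ) → 1 ≤ a → a < p →
    MulClosure p {{prime⇒nonZero pr}} a
lemma1 p pr a 1≤a a<p =
  subst (MulClosure p) (m<n⇒m%n≡m a<p) (closure-all a 1≤a a<p)
  where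
  open Closure p pr
  open ModPrime p pr using (p≢0)
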